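{- Let $A$ and $B$ be two FDDS, let $\alpha$ be the number of unroll trees of $\mathcal{U}(B)$, and let $n\ge 2\alpha+\mathrm{depth}(\mathcal{U}(B))$. If $[\mathcal{U}(A)]_n=[\mathcal{U}(B)]_n$ then $\mathrm{depth}(A)=\mathrm{depth}(B)$.
   Context: A finite discrete-time dynamical system (FDDS) is a pair $(S,f)$ with $S$ finite and $f:S\to S$, considered up to isomorphism. A state is periodic if it lies on a cycle. The depth of an FDDS is the maximum over states $s$ of the least $t\ge0$ with $f^t(s)$ periodic. For a periodic state $u$, the unroll tree in $u$ is the infinite rooted tree with vertex set $\{(s,k)\mid k\in\mathbb{N},\ f^k(s)=u\}$, root $(u,0)$ and arcs $(v,k)\to(f(v),k-1)$. The unroll $\mathcal{U}(A)$ is the multiset of unroll trees of $A$ (one per periodic state), and $\mathrm{depth}(\mathcal{U}(A))=\mathrm{depth}(A)$. The depth of a node is its distance to the root; $[\mathbf{t}]_n$ is the induced subtree on vertices of depth at most $n$, applied treewise to multisets. Equality means isomorphism of multisets of rooted trees. -}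

module Defs where

open import Data.Nat using (ℕ; zero; suc; _≤_; _<_)
open import Data.Fin using (Fin)
open import Data.Product using (Σ; ∃; _×_; _,_; proj₁; proj₂)
open import Data.Unit using (⊤)
open import Relation.Nullary using (¬_)
open import Relation.Binary.PropositionalEquality using (_≡_)

record FDDS : Set where
  field
    size : ℕ
    f    : Fin size → Fin size

open FDDS public

iter : {X : Set} → (X → X) → ℕ → X → X
iter g zero    x = x
iter g (suc k) x = g (iter g k x)

Periodic : (A : FDDS) → Fin (size A) → Set
Periodic A s = ∃ λ k → iter (f A) (suc k) s ≡ s

-- depth(A) = d : every state reaches a periodic state within d steps,
-- and some state needs at least d steps (so the max of the least times is d).
IsDepth : FDDS → ℕ → Set
IsDepth A d =
  (∀ s → ∃ λ t → t ≤ d × Periodic A (iter (f A) t s)) ×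
  (∃ λ s → ∀ t → t < d → ¬ Periodic A (iter (f A) t s))

record SubBij {X Y : Set} (P : X → Set) (Q : Y → Set) : Set where
  field
    to      : X → Y
    from    : Y → X
    to-Q    : ∀ x → P x → Q (to x)
    from-P  : ∀ y → Q y → P (from y)
    from-to : ∀ x → P x → from (to x) ≡ x
    to-from : ∀ y → Q y → to (from y) ≡ y

open SubBij public

-- Vertices of the truncation [t_u]_n of the unroll tree of A in u:
-- pairs (s , k) with k ≤ n and f^k(s) = u.
Vertex : (A : FDDS) → Fin (size A) → ℕ → Fin (size A) × ℕ → Set
Vertex A u n (s , k) = k ≤ n × iter (f A) k s ≡ u

Arc : (A : FDDS) → Fin (size A) × ℕ → Fin (size A) × ℕ → Set
Arc A (s , k) (s' , k') = k ≡ suc k' × f A s ≡ s'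

TreeIso : (A : FDDS) → Fin (size A) → (B : FDDS) → Fin (size B) → ℕ → Set
TreeIso A u B v n =
  Σ (SubBij (Vertex A u n) (Vertex B v n)) λ φ →
    (to φ (u , 0) ≡ (v , 0)) ×
    (∀ x y → Vertex A u n x → Vertex A u n y →
       (Arc A x y → Arc B (to φ x) (to φ y)) ×
       (Arc B (to φ x) (to φ y) → Arc A x y))

-- [U(A)]_n = [U(B)]_n as multisets of rooted trees up to isomorphism:
-- a bijection π between periodic states of A and of B with
-- [t_u]_n ≅ [t_{π u}]_n for every periodic u.
TruncUnrollEq : FDDS → FDDS → ℕ → Set
TruncUnrollEq A B n =
  Σ (SubBij (Periodic A) (Periodic B)) λ π →
    ∀ u → Periodic A u → TreeIso A u B (to π u) n

-- U(B) consists of exactly α unroll trees (one per periodic state).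
NumUnrollTrees : FDDS → ℕ → Set
NumUnrollTrees B α = SubBij {Fin α} (λ _ → ⊤) (Periodic B)

-- A tree isomorphism [t_u]_n ≅ [t_v]_n preserves levels and commutes with the maps,
-- so it carries (s , k) to (s' , k) and f^j s to f^j s'. When n > depth(B), the
-- periodic predecessor of u is sent to the periodic predecessor of v: walk back
-- d + 1 steps along the cycle of u and push the image forward d steps, which lands
-- on a periodic state of B. As periodic states have at most one periodic
-- predecessor, a level-1 vertex is periodic iff its image is. Consequently a state
-- s with f^(d+1) s periodic already has f^d s periodic (giving depth(A) ≤ d), and
-- pulling back a state of B of depth d gives a state of A of depth ≥ d. Only α ≥ 1,
-- i.e. n > d, is used from the bound on n.
module Submission where

open import Defs
open import Data.Nat using (ℕ; zero; suc; _+_; _*_; _∸_; _≤_; _<_; s≤s; z≤n)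
open import Data.Nat.Properties using (+-comm; +-suc; *-comm; m∸n+n≡m; m≤n+m; m≤m+n; ≤-refl; ≤-trans; <⇒≤; n<1+n)
open import Data.Fin using (Fin; toℕ)
open import Data.Fin.Properties using (pigeonhole)
open import Data.Product using (∃; _×_; _,_; proj₁; proj₂)
open import Relation.Nullary using (¬_)
open import Relation.Binary.PropositionalEquality
open ≡-Reasoning

module _ {X : Set} (g : X → X) where

  iter-+ : ∀ a b x → iter g a (iter g b x) ≡ iter g (a + b) x
  iter-+ zero    b x = refl
  iter-+ (suc a) b x = cong g (iter-+ a b x)

  iter-sucʳ : ∀ k x → iter g (suc k) x ≡ iter g k (g x)
  iter-sucʳ zero    x = refl
  iter-sucʳ (suc k) x = cong g (iter-sucʳ k x)

  iter-comm : ∀ a b x → iter g a (iter g b x) ≡ iter g b (iter g a x)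
  iter-comm a b x = begin
    iter g a (iter g b x) ≡⟨ iter-+ a b x ⟩
    iter g (a + b) x      ≡⟨ cong (λ m → iter g m x) (+-comm a b) ⟩
    iter g (b + a) x      ≡⟨ sym (iter-+ b a x) ⟩
    iter g b (iter g a x) ∎

  iter-*-fixed : ∀ p x → iter g p x ≡ x → ∀ m → iter g (m * p) x ≡ x
  iter-*-fixed p x e zero    = refl
  iter-*-fixed p x e (suc m) = begin
    iter g (p + m * p) x        ≡⟨ sym (iter-+ p (m * p) x) ⟩
    iter g p (iter g (m * p) x) ≡⟨ cong (iter g p) (iter-*-fixed p x e m) ⟩
    iter g p x                  ≡⟨ e ⟩
    x                           ∎

module _ (A : FDDS) where

  private
    F = iter (f A)

  Periodic-iter : ∀ {x} → Periodic A x → ∀ j → Periodic A (F j x)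
  Periodic-iter {x} (k , e) j = k , trans (iter-comm (f A) (suc k) j x) (cong (F j) e)

  Periodic-later : ∀ {t m y} → t ≤ m → Periodic A (F t y) → Periodic A (F m y)
  Periodic-later {t} {m} {y} t≤m P = subst (Periodic A) t+[m∸t]≡m (Periodic-iter P (m ∸ t))
    where
    t+[m∸t]≡m : F (m ∸ t) (F t y) ≡ F m y
    t+[m∸t]≡m = trans (iter-+ (f A) (m ∸ t) t y) (cong (λ k → F k y) (m∸n+n≡m t≤m))

  periodic-pred : ∀ {x} → Periodic A x → ∃ λ c → Periodic A c × f A c ≡ x
  periodic-pred {x} (k , e) = F k x , Periodic-iter (k , e) k , e

  periodic-ancestor : ∀ m {u} → Periodic A u → ∃ λ w → Periodic A w × F m w ≡ u
  periodic-ancestor zero    {u} Pu = u , Pu , refl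
  periodic-ancestor (suc m) Pu with periodic-ancestor m Pu
  ... | w , Pw , Fm[w]≡u with periodic-pred Pw
  ... | c , Pc , fc≡w = c , Pc , trans (iter-sucʳ (f A) m c) (trans (cong (F m) fc≡w) Fm[w]≡u)

  -- Both a and b are fixed by f^(pq), where p and q are their periods.
  periodic-f-injective : ∀ {a b} → Periodic A a → Periodic A b → f A a ≡ f A b → a ≡ b
  periodic-f-injective {a} {b} (k , ea) (j , eb) fa≡fb = begin
    a                           ≡⟨ sym (iter-*-fixed (f A) (suc k) a ea (suc j)) ⟩
    F (suc j * suc k) a         ≡⟨ cong (λ m → F m a) (*-comm (suc j) (suc k)) ⟩
    F (suc k * suc j) a         ≡⟨ iter-sucʳ (f A) N a ⟩
    F N (f A a)                 ≡⟨ cong (F N) fa≡fb ⟩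
    F N (f A b)                 ≡⟨ sym (iter-sucʳ (f A) N b) ⟩
    F (suc k * suc j) b         ≡⟨ iter-*-fixed (f A) (suc j) b eb (suc k) ⟩
    b                           ∎
    where N = j + k * suc j

  eventually-periodic : ∀ s → ∃ λ i → Periodic A (F i s)
  eventually-periodic s with pigeonhole (n<1+n (size A)) (λ (i : Fin (suc (size A))) → F (toℕ i) s)
  ... | i , j , i<j , Fi≡Fj = toℕ i , c , (begin
    F (suc c) (F (toℕ i) s) ≡⟨ iter-+ (f A) (suc c) (toℕ i) s ⟩
    F (suc c + toℕ i) s     ≡⟨ cong (λ m → F m s) (trans (sym (+-suc c (toℕ i))) (m∸n+n≡m i<j)) ⟩
    F (toℕ j) s             ≡⟨ sym Fi≡Fj ⟩
    F (toℕ i) s             ∎)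
    where c = toℕ j ∸ suc (toℕ i)

  periodic-at-depth : ∀ d → (∀ s → Periodic A (F (suc d) s) → Periodic A (F d s)) →
    ∀ s → Periodic A (F d s)
  periodic-at-depth d step s with eventually-periodic s
  ... | i , Pi = descend i s (Periodic-later (m≤m+n i d) Pi)
    where
    descend : ∀ e s → Periodic A (F (e + d) s) → Periodic A (F d s)
    descend zero    s P = P
    descend (suc e) s P =
      step s (subst (Periodic A) (sym (iter-sucʳ (f A) d s))
        (descend e (f A s) (subst (Periodic A) (iter-sucʳ (f A) (e + d) s) P)))

module TreeIsoProperties (A B : FDDS) (u : Fin (size A)) (v : Fin (size B)) (n : ℕ)
                         (φ : TreeIso A u B v n) where

  ψ : SubBij (Vertex A u n) (Vertex B v n)
  ψ = proj₁ φ

  img : Fin (size A) → ℕ → Fin (size B)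
  img s k = proj₁ (to ψ (s , k))

  Vertex-f : ∀ {s k} → Vertex A u n (s , suc k) → Vertex A u n (f A s , k)
  Vertex-f {s} {k} (sk≤n , e) = <⇒≤ sk≤n , trans (sym (iter-sucʳ (f A) k s)) e

  to-arc : ∀ {s k} (V : Vertex A u n (s , suc k)) → Arc B (to ψ (s , suc k)) (to ψ (f A s , k))
  to-arc {s} {k} V = proj₁ (proj₂ (proj₂ φ) (s , suc k) (f A s , k) V (Vertex-f V)) (refl , refl)

  to-level : ∀ {s} k → Vertex A u n (s , k) → proj₂ (to ψ (s , k)) ≡ k
  to-level zero    (_ , refl) = cong proj₂ (proj₁ (proj₂ φ))
  to-level (suc k) V          = trans (proj₁ (to-arc V)) (cong suc (to-level k (Vertex-f V)))

  to-img : ∀ {s k} → Vertex A u n (s , k) → to ψ (s , k) ≡ (img s k , k)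
  to-img {s} {k} V = cong (img s k ,_) (to-level k V)

  img-f : ∀ {s k} → Vertex A u n (s , suc k) → img (f A s) k ≡ f B (img s (suc k))
  img-f V = sym (proj₂ (to-arc V))

  img-iter : ∀ j {k s} → Vertex A u n (s , j + k) → img (iter (f A) j s) k ≡ iter (f B) j (img s (j + k))
  img-iter zero    V = refl
  img-iter (suc j) {k} {s} V = begin
    img (iter (f A) (suc j) s) k              ≡⟨ cong (λ x → img x k) (iter-sucʳ (f A) j s) ⟩
    img (iter (f A) j (f A s)) k              ≡⟨ img-iter j (Vertex-f V) ⟩
    iter (f B) j (img (f A s) (j + k))        ≡⟨ cong (iter (f B) j) (img-f V) ⟩
    iter (f B) j (f B (img s (suc j + k)))    ≡⟨ sym (iter-sucʳ (f B) j _) ⟩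
    iter (f B) (suc j) (img s (suc j + k))    ∎

  img-iter-level1 : ∀ j {s} → Vertex A u n (s , suc j) → img (iter (f A) j s) 1 ≡ iter (f B) j (img s (suc j))
  img-iter-level1 j {s} = subst (λ m → Vertex A u n (s , m) → img (iter (f A) j s) 1 ≡ iter (f B) j (img s m))
                                (+-comm j 1) (img-iter j)

  img-injective : ∀ {x y k} → Vertex A u n (x , k) → Vertex A u n (y , k) → img x k ≡ img y k → x ≡ y
  img-injective {x} {y} {k} Vx Vy e = cong proj₁ (begin
    (x , k)                ≡⟨ sym (from-to ψ _ Vx) ⟩
    from ψ (to ψ (x , k))  ≡⟨ cong (from ψ) (trans (to-img Vx) (trans (cong (_, k) e) (sym (to-img Vy)))) ⟩
    from ψ (to ψ (y , k))  ≡⟨ from-to ψ _ Vy ⟩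
    (y , k)                ∎)

  preimage : ∀ {t k} → Vertex B v n (t , k) → ∃ λ s → Vertex A u n (s , k) × img s k ≡ t
  preimage {t} {k} V with from ψ (t , k) | from-P ψ _ V | to-from ψ _ V
  ... | s , j | Vs | e with trans (sym (to-level j Vs)) (cong proj₂ e)
  ... | refl = s , Vs , cong proj₁ e

  img-pred-root : ∀ {x} → 1 ≤ n → f A x ≡ u → f B (img x 1) ≡ v
  img-pred-root {x} 1≤n fx≡u = cong proj₁ (begin
    (f B (img x 1) , 0) ≡⟨ cong (_, 0) (sym (img-f V)) ⟩
    (img (f A x) 0 , 0) ≡⟨ sym (to-img (Vertex-f V)) ⟩
    to ψ (f A x , 0)    ≡⟨ cong (λ y → to ψ (y , 0)) fx≡u ⟩
    to ψ (u , 0)        ≡⟨ proj₁ (proj₂ φ) ⟩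
    (v , 0)             ∎)
    where V : Vertex A u n (x , 1)
          V = 1≤n , fx≡u

  module BeyondDepthB (d : ℕ) (cycleB : ∀ s → Periodic B (iter (f B) d s)) (d<n : d < n) where

    1≤n : 1 ≤ n
    1≤n = ≤-trans (s≤s z≤n) d<n

    img-periodic-pred : ∀ {x} → Periodic A x → f A x ≡ u → Periodic B (img x 1)
    img-periodic-pred {x} Px fx≡u with periodic-ancestor A (suc d) (subst (Periodic A) fx≡u (Periodic-iter A Px 1))
    ... | w , Pw , F[w]≡u = subst (Periodic B) (sym img-x≡Fd-img-w) (cycleB (img w (suc d)))
      where
      Fd[w]≡x : iter (f A) d w ≡ x
      Fd[w]≡x = periodic-f-injective A (Periodic-iter A Pw d) Px (trans F[w]≡u (sym fx≡u))
      img-x≡Fd-img-w : img x 1 ≡ iter (f B) d (img w (suc d))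
      img-x≡Fd-img-w = subst (λ y → img y 1 ≡ _) Fd[w]≡x (img-iter-level1 d (d<n , F[w]≡u))

    periodic-if-img : Periodic A u → ∀ {x} → f A x ≡ u → Periodic B (img x 1) → Periodic A x
    periodic-if-img Pu {x} fx≡u Pimg with periodic-pred A Pu
    ... | c , Pc , fc≡u = subst (Periodic A) (sym x≡c) Pc
      where
      img-x≡img-c : img x 1 ≡ img c 1
      img-x≡img-c = periodic-f-injective B Pimg (img-periodic-pred Pc fc≡u)
                        (trans (img-pred-root 1≤n fx≡u) (sym (img-pred-root 1≤n fc≡u)))
      x≡c : x ≡ c
      x≡c = img-injective (1≤n , fx≡u) (1≤n , fc≡u) img-x≡img-c

module _ (A B : FDDS) (n : ℕ) (eq : TruncUnrollEq A B n) where

  private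
    π = proj₁ eq
    trees = proj₂ eq

  depth-upper : ∀ d → (∀ s → Periodic B (iter (f B) d s)) → d < n → ∀ s → Periodic A (iter (f A) d s)
  depth-upper d cycleB d<n = periodic-at-depth A d step
    where
    step : ∀ s → Periodic A (iter (f A) (suc d) s) → Periodic A (iter (f A) d s)
    step s Pu = periodic-if-img Pu refl (subst (Periodic B) (sym (img-iter-level1 d (d<n , refl))) (cycleB _))
      where open TreeIsoProperties A B (iter (f A) (suc d) s) (to π _) n (trees _ Pu)
            open BeyondDepthB d cycleB d<n

  depth-lower : ∀ d → (∀ s → Periodic B (iter (f B) d s)) → d < n →
    ∀ {sB} → (∀ t → t < d → ¬ Periodic B (iter (f B) t sB)) →
    ∃ λ s → ∀ t → t < d → ¬ Periodic A (iter (f A) t s)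
  depth-lower zero     _      _   {sB} _    = from π sB , λ _ ()
  depth-lower (suc d') cycleB d<n {sB} notB = x , never-periodic
    where
    u = from π (iter (f B) (suc d') sB)
    open TreeIsoProperties A B u (to π u) n (trees u (from-P π _ (cycleB sB)))
    open BeyondDepthB (suc d') cycleB d<n
    pulled = preimage (<⇒≤ d<n , sym (to-from π _ (cycleB sB)))
    x = proj₁ pulled
    Vx = proj₁ (proj₂ pulled)
    img-Fx≡F-sB : img (iter (f A) d' x) 1 ≡ iter (f B) d' sB
    img-Fx≡F-sB = trans (img-iter-level1 d' Vx) (cong (iter (f B) d') (proj₂ (proj₂ pulled)))
    never-periodic : ∀ t → t < suc d' → ¬ Periodic A (iter (f A) t x)
    never-periodic t (s≤s t≤d') Pt = notB d' (n<1+n d')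
      (subst (Periodic B) img-Fx≡F-sB (img-periodic-pred (Periodic-later A t≤d' Pt) (proj₂ Vx)))

count-positive⇒depth<bound : ∀ {α d n} → Fin α → 2 * α + d ≤ n → d < n
count-positive⇒depth<bound {suc a} {d} _ le = ≤-trans (s≤s (m≤n+m d _)) le

lemma5 : (A B : FDDS) (α n d : ℕ) →
    NumUnrollTrees B α → IsDepth B d → 2 * α + d ≤ n →
    TruncUnrollEq A B n → IsDepth A d
lemma5 A B α n d num (reachB , sB , notB) bound eq =
  (λ s → d , ≤-refl , depth-upper A B n eq d cycleB d<n s) ,
  depth-lower A B n eq d cycleB d<n notB
  where
  cycleB : ∀ s → Periodic B (iter (f B) d s)
  cycleB s = let (t , t≤d , Pt) = reachB s in Periodic-later B t≤d Pt
  d<n : d < n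
  d<n = count-positive⇒depth<bound (from num (iter (f B) d sB)) bound
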